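{- Consider the online bipartite matching setting with the SAP protocol, at some point during the insertion sequence, with current matching $M$, and let $\alpha_M$ be as in the context. For any server $s\in S$, there is an augmenting tail from $s$ to an unmatched server if and only if $\alpha_M(s)<1$.
   Context: SAP protocol: when a client $c$ arrives, if there is an augmenting path (alternating between unmatched and matched edges, from $c$ to an unmatched server) it augments along a shortest one; otherwise it does nothing. $C_M$ is the set of arrived clients $c$ such that, at the moment $c$ was inserted, the maximum matching size of the graph increased; $G_M$ is the subgraph induced on $C_M\cup S$. $\alpha_M$ is the balanced server flow of $G_M$: a server flow is a map $\alpha:S\to\mathbb R_{\ge0}$ for which there exist nonnegative $(x_e)$ with $\sum_{s\in N(c)}x_{cs}=1$ for every client $c$ and $\sum_{c\in N(s)}x_{cs}=\alpha(s)$ for every server $s$; it is balanced if such $x$ can be chosen with $x_{cs}=0$ whenever $s\notin\arg\min_{s'\in N(c)}\alpha(s')$; its values are unique. An augmenting tail from $v$ is an alternating path (w.r.t. $M$) starting at $v$ and ending at an unmatched server.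
   Formalization: The balanced server flow $\alpha_M$ and the values $x_{cs}$ realising it take values in the nonnegative rationals instead of the nonnegative reals. -}

module Defs where

open import Data.Nat using (ℕ; zero; suc; _<_; _≤_)
open import Data.Fin using (Fin; toℕ; fromℕ<) renaming (_≟_ to _≟F_)
import Data.Fin as F
open import Data.Bool using (Bool; true; false; _∧_; _∨_; _xor_)
open import Data.List using (List; []; _∷_; map; length)
open import Data.List.Relation.Unary.Unique.Propositional using (Unique)
open import Data.List.Membership.Propositional using (_∈_)
open import Data.Product using (Σ; _×_; _,_; proj₁; proj₂)
open import Data.Sum using (_⊎_)
open import Data.Empty using (⊥)
open import Relation.Nullary using (¬_; does)
open import Relation.Binary.PropositionalEquality using (_≡_; _≢_)
open import Data.Rational as Q using (ℚ; 0ℚ; 1ℚ)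

-- Servers are Fin m, clients are Fin n; client number t is the
-- (t+1)-st to arrive.  The whole (finite) arrival sequence is given by a
-- Boolean adjacency relation  Adj : Fin n → Fin m → Bool.
-- After t arrivals, the current graph G has the clients c with toℕ c < t.

Adjacency : ℕ → ℕ → Set
Adjacency n m = Fin n → Fin m → Bool

Edge : ∀ {n m} → Adjacency n m → ℕ → Fin n → Fin m → Set
Edge Adj t c s = (toℕ c < t) × (Adj c s ≡ true)

EdgeSet : ℕ → ℕ → Set
EdgeSet n m = Fin n → Fin m → Bool

ServerFree : ∀ {n m} → EdgeSet n m → Fin m → Set
ServerFree M s = ∀ c → M c s ≡ false

sumℕ : ∀ {k} → (Fin k → ℕ) → ℕ
sumℕ {zero} f = 0
sumℕ {suc k} f = f F.zero Data.Nat.+ sumℕ (λ i → f (F.suc i))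

sumℚ : ∀ {k} → (Fin k → ℚ) → ℚ
sumℚ {zero} f = 0ℚ
sumℚ {suc k} f = f F.zero Q.+ sumℚ (λ i → f (F.suc i))

IsMatching : ∀ {n m} → (Fin n → Fin m → Set) → EdgeSet n m → Set
IsMatching {n} {m} E N =
  (∀ c s → N c s ≡ true → E c s) ×
  (∀ c s s′ → N c s ≡ true → N c s′ ≡ true → s ≡ s′) ×
  (∀ c c′ s → N c s ≡ true → N c′ s ≡ true → c ≡ c′)

size : ∀ {n m} → EdgeSet n m → ℕ
size N = sumℕ (λ c → sumℕ (λ s → if N c s then 1 else 0))
  where open import Data.Bool using (if_then_else_)

MaxIncreasedAt : ∀ {n m} → Adjacency n m → ℕ → Set
MaxIncreasedAt Adj k =
  Σ _ λ N → IsMatching (Edge Adj (suc k)) N ×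
    (∀ N′ → IsMatching (Edge Adj k) N′ → size N′ < size N)

-- A path  c₀ s₀ c₁ s₁ … c_k s_k  is recorded as the list of pairs
-- (c₀ , s₀) ∷ (c₁ , s₁) ∷ … ∷ (c_k , s_k) : the edges cᵢ sᵢ are
-- non-matching edges of the graph, the edges c_{i+1} sᵢ are matching
-- edges, and s_k is unmatched.

data AltPath {n m} (E : Fin n → Fin m → Set) (M : EdgeSet n m)
     : Fin n → List (Fin n × Fin m) → Set where
  last : ∀ {c s} → E c s → M c s ≡ false → ServerFree M s →
         AltPath E M c ((c , s) ∷ [])
  cons : ∀ {c s c′ p} → E c s → M c s ≡ false → M c′ s ≡ true →
         AltPath E M c′ p → AltPath E M c ((c , s) ∷ p)

Simple : ∀ {n m} → List (Fin n × Fin m) → Set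
Simple p = Unique (map proj₁ p) × Unique (map proj₂ p)

pathEdges : ∀ {n m} → List (Fin n × Fin m) → List (Fin n × Fin m)
pathEdges [] = []
pathEdges ((c , s) ∷ []) = (c , s) ∷ []
pathEdges ((c , s) ∷ (c′ , s′) ∷ r) = (c , s) ∷ (c′ , s) ∷ pathEdges ((c′ , s′) ∷ r)

memb : ∀ {n m} → Fin n → Fin m → List (Fin n × Fin m) → Bool
memb c s [] = false
memb c s ((c′ , s′) ∷ r) = (does (c ≟F c′) ∧ does (s ≟F s′)) ∨ memb c s r

-- Runs of the SAP protocol:  SAPRun Adj t M  means M is a possible
-- matching after the first t clients have arrived and been processed.

data SAPRun {n m} (Adj : Adjacency n m) : ℕ → EdgeSet n m → Set where
  start : SAPRun Adj 0 (λ _ _ → false)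
  augment : ∀ {t M M′ p} (lt : t < n) → SAPRun Adj t M →
    AltPath (Edge Adj (suc t)) M (fromℕ< lt) p → Simple p →
    (∀ q → AltPath (Edge Adj (suc t)) M (fromℕ< lt) q → Simple q →
       length p ≤ length q) →
    (∀ c s → M′ c s ≡ (M c s xor memb c s (pathEdges p))) →
    SAPRun Adj (suc t) M′
  skip : ∀ {t M} (lt : t < n) → SAPRun Adj t M →
    (∀ q → AltPath (Edge Adj (suc t)) M (fromℕ< lt) q → Simple q → ⊥) →
    SAPRun Adj (suc t) M

InCM : ∀ {n m} → Adjacency n m → ℕ → Fin n → Set
InCM Adj t c = (toℕ c < t) × MaxIncreasedAt Adj (toℕ c)

EdgeGM : ∀ {n m} → Adjacency n m → ℕ → Fin n → Fin m → Set
EdgeGM Adj t c s = InCM Adj t c × (Adj c s ≡ true)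

IsBalancedServerFlow : ∀ {n m} → Adjacency n m → ℕ → (Fin m → ℚ) → Set
IsBalancedServerFlow {n} {m} Adj t α =
  Σ (Fin n → Fin m → ℚ) λ x →
    (∀ c s → 0ℚ Q.≤ x c s) ×
    (∀ c s → ¬ EdgeGM Adj t c s → x c s ≡ 0ℚ) ×
    (∀ c → InCM Adj t c → sumℚ (λ s → x c s) ≡ 1ℚ) ×
    (∀ s → sumℚ (λ c → x c s) ≡ α s) ×
    (∀ c s → x c s ≢ 0ℚ → ∀ s′ → EdgeGM Adj t c s′ → α s Q.≤ α s′)

AugTail : ∀ {n m} → (Fin n → Fin m → Set) → EdgeSet n m → Fin m → Set
AugTail E M s =
  ServerFree M s ⊎
  Σ _ λ c → M c s ≡ true × Σ _ λ p →
    AltPath E M c p × Simple p × ¬ (s ∈ map proj₂ p)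

module Submission where

-- The proof has two independent halves.
-- (1) An invariant of SAP runs (SAPInvariant, sap-invariant): M is a matching
--     of the current graph, its matched clients are exactly the arrived clients
--     of C_M, and a vertex cover of size |M| certifies that M is maximum.  An
--     augmentation adds the new client to the cover; when SAP does nothing, the
--     servers alternately reachable from the new client's neighbours form a
--     closed set of matched servers, which replaces their mates in the cover.
-- (2) For any matching and any balanced load on it -- a fractional assignment
--     of the matched clients that flows only to least-loaded neighbours -- a
--     server has an augmenting tail iff its load is below 1 (module Tails).
--     Both directions compare sizes of client and server sets with total loads.
-- By (1) the balanced server flow of G_M is such a load, which gives lemma31.

open import Defs
import Algebra.Properties.CommutativeMonoid.Sum as ∑Laws
open import Data.Bool using (Bool; true; false; _∧_; _∨_; not; _xor_; if_then_else_)
import Data.Bool as Bool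
open import Data.Bool.Properties using (∨-zeroʳ; ∧-identityʳ; ∧-zeroʳ)
open import Data.Empty using (⊥; ⊥-elim)
open import Data.Fin using (Fin; toℕ; fromℕ<) renaming (zero to fz; suc to fs; _≟_ to _≟F_)
open import Data.Fin.Properties using (any?; all?; ¬∀⟶∃¬; toℕ-injective; toℕ-fromℕ<) renaming (suc-injective to fs-injective)
open import Data.Nat using (ℕ; zero; suc; _+_; _≤_; _<_; _<?_; z≤n; s≤s)
open import Data.Nat.Properties
open import Data.List using (List; []; _∷_; map; filter; allFin)
import Data.List.Extrema as Extrema
open import Data.List.Membership.Propositional using (_∈_)
import Data.List.Membership.DecPropositional as DecMembership
open import Data.List.Membership.Propositional.Properties using (∈-map⁺; ∈-map⁻; ∈-filter⁺; ∈-allFin)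
open import Data.List.Relation.Unary.All as All using ([]; _∷_)
open import Data.List.Relation.Unary.All.Properties using (¬Any⇒All¬; All¬⇒¬Any; all-filter)
open import Data.List.Relation.Unary.AllPairs using ([]; _∷_)
open import Data.List.Relation.Unary.Any using (here; there)
open import Data.List.Relation.Unary.Unique.Propositional using (Unique)
open import Data.Product using (Σ; _×_; _,_; proj₁; proj₂)
open import Data.Rational as ℚ using (ℚ; 0ℚ; 1ℚ)
import Data.Rational.Properties as ℚP
open import Relation.Binary.Bundles using (DecTotalOrder)
open import Data.Sum using (_⊎_; inj₁; inj₂)
open import Function using (_∘_)
open import Relation.Binary.PropositionalEquality
open import Relation.Nullary using (¬_; Dec; does; yes; no)
open import Relation.Nullary.Decidable using (dec-true; dec-false; decidable-stable; _×-dec_; _→-dec_)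

false≢true : false ≢ true
false≢true ()

witness : ∀ {a} {A : Set a} (d : Dec A) → does d ≡ true → A
witness (yes a) _ = a

true-if-not-false : ∀ b → b ≢ false → b ≡ true
true-if-not-false true  _  = refl
true-if-not-false false ne = ⊥-elim (ne refl)

-- Sums over Fin k.  Rearrangement laws are taken from the library's sums
-- over commutative monoids, to which sumℕ and sumℚ agree pointwise.

module ∑ℕ = ∑Laws +-0-commutativeMonoid
module ∑ℚ = ∑Laws ℚP.+-0-commutativeMonoid

sumℕ≡∑ : ∀ {k} (f : Fin k → ℕ) → sumℕ f ≡ ∑ℕ.sum f
sumℕ≡∑ {zero}  f = refl
sumℕ≡∑ {suc k} f = cong (f fz +_) (sumℕ≡∑ (f ∘ fs))

sumℚ≡∑ : ∀ {k} (f : Fin k → ℚ) → sumℚ f ≡ ∑ℚ.sum f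
sumℚ≡∑ {zero}  f = refl
sumℚ≡∑ {suc k} f = cong (f fz ℚ.+_) (sumℚ≡∑ (f ∘ fs))

sumℕ-cong : ∀ {k} {f g : Fin k → ℕ} → (∀ i → f i ≡ g i) → sumℕ f ≡ sumℕ g
sumℕ-cong {zero}  e = refl
sumℕ-cong {suc k} e = cong₂ _+_ (e fz) (sumℕ-cong (e ∘ fs))

sumℕ-mono : ∀ {k} {f g : Fin k → ℕ} → (∀ i → f i ≤ g i) → sumℕ f ≤ sumℕ g
sumℕ-mono {zero}  le = z≤n
sumℕ-mono {suc k} le = +-mono-≤ (le fz) (sumℕ-mono (le ∘ fs))

sumℕ-mono-< : ∀ {k} {f g : Fin k → ℕ} → (∀ i → f i ≤ g i) → ∀ j → f j < g j → sumℕ f < sumℕ g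
sumℕ-mono-< {suc k} le fz     lt = +-mono-<-≤ lt (sumℕ-mono (le ∘ fs))
sumℕ-mono-< {suc k} le (fs j) lt = +-mono-≤-< (le fz) (sumℕ-mono-< (le ∘ fs) j lt)

sumℕ-distrib : ∀ {k} (f g : Fin k → ℕ) → sumℕ (λ i → f i + g i) ≡ sumℕ f + sumℕ g
sumℕ-distrib f g = begin
  sumℕ (λ i → f i + g i)        ≡⟨ sumℕ≡∑ (λ i → f i + g i) ⟩
  ∑ℕ.sum (λ i → f i + g i)      ≡⟨ ∑ℕ.∑-distrib-+ f g ⟩
  ∑ℕ.sum f + ∑ℕ.sum g           ≡⟨ sym (cong₂ _+_ (sumℕ≡∑ f) (sumℕ≡∑ g)) ⟩
  sumℕ f + sumℕ g               ∎
  where open ≡-Reasoning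

sumℕ-comm : ∀ {k l} (f : Fin k → Fin l → ℕ) →
  sumℕ (λ i → sumℕ (λ j → f i j)) ≡ sumℕ (λ j → sumℕ (λ i → f i j))
sumℕ-comm f = trans (double f) (trans (∑ℕ.∑-comm f) (sym (double (λ j i → f i j))))
  where
  double : ∀ {k l} (g : Fin k → Fin l → ℕ) →
    sumℕ (λ i → sumℕ (g i)) ≡ ∑ℕ.sum (λ i → ∑ℕ.sum (g i))
  double g = trans (sumℕ≡∑ (λ i → sumℕ (g i))) (∑ℕ.sum-cong-≗ (λ i → sumℕ≡∑ (g i)))

sumℕ-zeros : ∀ {k} (f : Fin k → ℕ) → (∀ i → f i ≡ 0) → sumℕ f ≡ 0
sumℕ-zeros {zero}  f z = refl
sumℕ-zeros {suc k} f z rewrite z fz = sumℕ-zeros (f ∘ fs) (z ∘ fs)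

sumℕ-term : ∀ {k} (f : Fin k → ℕ) j → f j ≤ sumℕ f
sumℕ-term f fz     = m≤m+n _ _
sumℕ-term f (fs j) = ≤-trans (sumℕ-term (f ∘ fs) j) (m≤n+m _ _)

sumℚ-cong : ∀ {k} {f g : Fin k → ℚ} → (∀ i → f i ≡ g i) → sumℚ f ≡ sumℚ g
sumℚ-cong {zero}  e = refl
sumℚ-cong {suc k} e = cong₂ ℚ._+_ (e fz) (sumℚ-cong (e ∘ fs))

sumℚ-mono : ∀ {k} {f g : Fin k → ℚ} → (∀ i → f i ℚ.≤ g i) → sumℚ f ℚ.≤ sumℚ g
sumℚ-mono {zero}  le = ℚP.≤-refl
sumℚ-mono {suc k} le = ℚP.+-mono-≤ (le fz) (sumℚ-mono (le ∘ fs))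

sumℚ-mono-< : ∀ {k} {f g : Fin k → ℚ} → (∀ i → f i ℚ.≤ g i) → ∀ j → f j ℚ.< g j → sumℚ f ℚ.< sumℚ g
sumℚ-mono-< {suc k} le fz     lt = ℚP.+-mono-<-≤ lt (sumℚ-mono (le ∘ fs))
sumℚ-mono-< {suc k} le (fs j) lt = ℚP.+-mono-≤-< (le fz) (sumℚ-mono-< (le ∘ fs) j lt)

sumℚ-comm : ∀ {k l} (f : Fin k → Fin l → ℚ) →
  sumℚ (λ i → sumℚ (λ j → f i j)) ≡ sumℚ (λ j → sumℚ (λ i → f i j))
sumℚ-comm f = trans (double f) (trans (∑ℚ.∑-comm f) (sym (double (λ j i → f i j))))
  where
  double : ∀ {k l} (g : Fin k → Fin l → ℚ) →
    sumℚ (λ i → sumℚ (g i)) ≡ ∑ℚ.sum (λ i → ∑ℚ.sum (g i))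
  double g = trans (sumℚ≡∑ (λ i → sumℚ (g i))) (∑ℚ.sum-cong-≗ (λ i → sumℚ≡∑ (g i)))

sumℚ-zeros : ∀ {k} → sumℚ {k} (λ _ → 0ℚ) ≡ 0ℚ
sumℚ-zeros {k} = trans (sumℚ≡∑ {k} (λ _ → 0ℚ)) (∑ℚ.sum-replicate-zero k)

sumℚ-nonneg : ∀ {k} (f : Fin k → ℚ) → (∀ i → 0ℚ ℚ.≤ f i) → 0ℚ ℚ.≤ sumℚ f
sumℚ-nonneg {k} f nn = subst (ℚ._≤ sumℚ f) (sumℚ-zeros {k}) (sumℚ-mono nn)

ind : Bool → ℕ
ind b = if b then 1 else 0

count : ∀ {k} → (Fin k → Bool) → ℕ
count P = sumℕ (ind ∘ P)

infix 4 _⊆_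
_⊆_ : ∀ {k} → (Fin k → Bool) → (Fin k → Bool) → Set
P ⊆ Q = ∀ i → P i ≡ true → Q i ≡ true

ind-mono : ∀ {a b : Bool} → (a ≡ true → b ≡ true) → ind a ≤ ind b
ind-mono {false} _ = z≤n
ind-mono {true}  h rewrite h refl = ≤-refl

count-empty : ∀ {k} (P : Fin k → Bool) → (∀ i → P i ≡ false) → count P ≡ 0
count-empty P none = sumℕ-zeros _ (λ i → cong ind (none i))

count-member : ∀ {k} (P : Fin k → Bool) j → P j ≡ true → 1 ≤ count P
count-member P j pj = ≤-trans (≤-reflexive (cong ind (sym pj))) (sumℕ-term (ind ∘ P) j)

count≤ : ∀ {k} (P : Fin k → Bool) → count P ≤ k
count≤ {zero}  P = z≤n
count≤ {suc k} P = +-mono-≤ (ind≤1 (P fz)) (count≤ (P ∘ fs))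
  where
  ind≤1 : ∀ b → ind b ≤ 1
  ind≤1 true  = ≤-refl
  ind≤1 false = z≤n

count-unique : ∀ {k} (P : Fin k → Bool) → (∀ i j → P i ≡ true → P j ≡ true → i ≡ j) → count P ≤ 1
count-unique {zero}  P u = z≤n
count-unique {suc k} P u with P fz in p0
... | true  = ≤-reflexive (cong suc (count-empty (P ∘ fs) rest-empty))
  where
  rest-empty : ∀ i → P (fs i) ≡ false
  rest-empty i with P (fs i) in pi
  ... | false = refl
  ... | true  with () ← u fz (fs i) p0 pi
... | false = count-unique (P ∘ fs) (λ i j pi pj → fs-injective (u (fs i) (fs j) pi pj))

count-mono-< : ∀ {k} {P Q : Fin k → Bool} → P ⊆ Q → ∀ j → P j ≡ false → Q j ≡ true → count P < count Q
count-mono-< {P = P} {Q} sub j pj qj = sumℕ-mono-< (λ i → ind-mono (sub i)) j ind<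
  where
  ind< : ind (P j) < ind (Q j)
  ind< rewrite pj | qj = ≤-refl

count-⊆-antisym : ∀ {k} {P Q : Fin k → Bool} → P ⊆ Q → count Q ≤ count P → Q ⊆ P
count-⊆-antisym {P = P} sub le i qi with P i in pi
... | true  = refl
... | false = ⊥-elim (<⇒≱ (count-mono-< sub i pi qi) le)

count-∪ : ∀ {k} (P Q : Fin k → Bool) → count (λ i → P i ∨ Q i) ≤ count P + count Q
count-∪ P Q = ≤-trans (sumℕ-mono (λ i → pointwise (P i) (Q i))) (≤-reflexive (sumℕ-distrib (ind ∘ P) (ind ∘ Q)))
  where
  pointwise : ∀ a b → ind (a ∨ b) ≤ ind a + ind b
  pointwise true  b = s≤s z≤n
  pointwise false b = ≤-refl

count-∪-new : ∀ {k} (P Q : Fin k → Bool) → count (λ i → P i ∨ Q i) ≤ count P + count (λ i → Q i ∧ not (P i))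
count-∪-new P Q = ≤-trans (sumℕ-mono (λ i → pointwise (P i) (Q i)))
                          (≤-reflexive (sumℕ-distrib (ind ∘ P) (λ i → ind (Q i ∧ not (P i)))))
  where
  pointwise : ∀ a b → ind (a ∨ b) ≤ ind a + ind (b ∧ not a)
  pointwise true  b     = s≤s z≤n
  pointwise false true  = ≤-refl
  pointwise false false = ≤-refl

count-unique-∧ : ∀ {k} (P : Fin k → Bool) (b : Bool) → (∀ i j → P i ≡ true → P j ≡ true → i ≡ j) →
  count (λ i → P i ∧ b) ≤ ind b
count-unique-∧ P true  u = count-unique _ (λ i j pi pj →
  u i j (trans (sym (∧-identityʳ _)) pi) (trans (sym (∧-identityʳ _)) pj))
count-unique-∧ P false u = ≤-reflexive (count-empty _ (λ i → ∧-zeroʳ (P i)))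

count-split : ∀ {k} (P Z : Fin k → Bool) → count (λ i → P i ∧ not (Z i)) + count (λ i → P i ∧ Z i) ≡ count P
count-split P Z = trans (sym (sumℕ-distrib (λ i → ind (P i ∧ not (Z i))) (λ i → ind (P i ∧ Z i))))
                        (sumℕ-cong (λ i → pointwise (P i) (Z i)))
  where
  pointwise : ∀ a z → ind (a ∧ not z) + ind (a ∧ z) ≡ ind a
  pointwise true  true  = refl
  pointwise true  false = refl
  pointwise false z     = refl

count-injection : ∀ {k l} (A : Fin l → Bool) (B : Fin k → Bool) (R : Fin k → Fin l → Bool) →
  (∀ s → A s ≡ true → Σ (Fin k) λ c → R c s ≡ true × B c ≡ true) →
  (∀ c s s′ → R c s ≡ true → R c s′ ≡ true → s ≡ s′) →
  count A ≤ count B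
count-injection A B R covered functional = begin
  count A                                   ≤⟨ sumℕ-mono column ⟩
  sumℕ (λ s → count (λ c → R c s ∧ B c))    ≡⟨ sumℕ-comm (λ s c → ind (R c s ∧ B c)) ⟩
  sumℕ (λ c → count (λ s → R c s ∧ B c))    ≤⟨ sumℕ-mono row ⟩
  count B                                   ∎
  where
  open ≤-Reasoning
  column : ∀ s → ind (A s) ≤ count (λ c → R c s ∧ B c)
  column s with A s in as
  ... | false = z≤n
  ... | true  with covered s as
  ...   | c , r , b = count-member (λ c → R c s ∧ B c) c (cong₂ _∧_ r b)
  row : ∀ c → count (λ s → R c s ∧ B c) ≤ ind (B c)
  row c = count-unique-∧ (R c) (B c) (functional c)

ι : ℕ → ℚ
ι zero    = 0ℚ
ι (suc n) = 1ℚ ℚ.+ ι n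

restrict : Bool → ℚ → ℚ
restrict b q = if b then q else 0ℚ

ι-+ : ∀ a b → ι (a + b) ≡ ι a ℚ.+ ι b
ι-+ zero    b = sym (ℚP.+-identityˡ (ι b))
ι-+ (suc a) b rewrite ι-+ a b = sym (ℚP.+-assoc 1ℚ (ι a) (ι b))

sumℚ-count : ∀ {k} (P : Fin k → Bool) → sumℚ (λ i → restrict (P i) 1ℚ) ≡ ι (count P)
sumℚ-count {zero}  P = refl
sumℚ-count {suc k} P = trans (cong₂ ℚ._+_ (ι-ind (P fz)) (sumℚ-count (P ∘ fs)))
                             (sym (ι-+ (ind (P fz)) (count (P ∘ fs))))
  where
  ι-ind : ∀ b → restrict b 1ℚ ≡ ι (ind b)
  ι-ind true  = sym (ℚP.+-identityʳ 1ℚ)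
  ι-ind false = refl

ι-step : ∀ a → ι a ℚ.< ι (suc a)
ι-step a = subst (ℚ._< 1ℚ ℚ.+ ι a) (ℚP.+-identityˡ (ι a)) (ℚP.+-monoˡ-< (ι a) (ℚP.positive⁻¹ _))

ι-mono-< : ∀ {a b} → a < b → ι a ℚ.< ι b
ι-mono-< {a} {suc b} (s≤s a≤b) with m≤n⇒m<n∨m≡n a≤b
... | inj₁ a<b  = ℚP.<-trans (ι-mono-< a<b) (ι-step b)
... | inj₂ refl = ι-step a

ι-mono-≤ : ∀ {a b} → a ≤ b → ι a ℚ.≤ ι b
ι-mono-≤ le with m≤n⇒m<n∨m≡n le
... | inj₁ lt   = ℚP.<⇒≤ (ι-mono-< lt)
... | inj₂ refl = ℚP.≤-refl

ι-cancel-≤ : ∀ {a b} → ι a ℚ.≤ ι b → a ≤ b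
ι-cancel-≤ {a} {b} le with a ≤? b
... | yes a≤b = a≤b
... | no  a≰b = ⊥-elim (ℚP.<-irrefl refl (ℚP.<-≤-trans (ι-mono-< (≰⇒> a≰b)) le))

sumℚ-restrict : ∀ {k} b (f : Fin k → ℚ) → restrict b (sumℚ f) ≡ sumℚ (λ c → restrict b (f c))
sumℚ-restrict true  f = refl
sumℚ-restrict {k} false f = sym (sumℚ-zeros {k})

minimum-on : ∀ {k} (f : Fin k → ℚ) (R : Fin k → Bool) j → R j ≡ true →
  Σ (Fin k) λ i → R i ≡ true × (∀ r → R r ≡ true → f i ℚ.≤ f r)
minimum-on {k} f R j rj =
  argmin f j candidates ,
  argmin-all f rj (all-filter inR? (allFin k)) ,
  λ r rr → All.lookup (f[argmin]≤f[xs] j candidates) (∈-filter⁺ inR? (∈-allFin r) rr)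
  where
  open Extrema (DecTotalOrder.totalOrder ℚP.≤-decTotalOrder)
  inR? : ∀ r → Dec (R r ≡ true)
  inR? r = R r Bool.≟ true
  candidates : List (Fin k)
  candidates = filter inR? (allFin k)

clients : ∀ {n m} → List (Fin n × Fin m) → List (Fin n)
clients = map proj₁

servers : ∀ {n m} → List (Fin n × Fin m) → List (Fin m)
servers = map proj₂

memb⇒∈ : ∀ {n m} (c : Fin n) (s : Fin m) l → memb c s l ≡ true → (c , s) ∈ l
memb⇒∈ c s ((c′ , s′) ∷ r) e with c ≟F c′ | s ≟F s′
... | yes refl | yes refl = here refl
... | yes _    | no _     = there (memb⇒∈ c s r e)
... | no _     | _        = there (memb⇒∈ c s r e)

∈⇒memb : ∀ {n m} (c : Fin n) (s : Fin m) l → (c , s) ∈ l → memb c s l ≡ true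
∈⇒memb c s (_ ∷ r) (here refl) rewrite dec-true (c ≟F c) refl | dec-true (s ≟F s) refl = refl
∈⇒memb c s (_ ∷ r) (there i) rewrite ∈⇒memb c s r i = ∨-zeroʳ _

∉⇒memb : ∀ {n m} (c : Fin n) (s : Fin m) l → ¬ ((c , s) ∈ l) → memb c s l ≡ false
∉⇒memb c s l ∉l with memb c s l in e
... | true  = ⊥-elim (∉l (memb⇒∈ c s l e))
... | false = refl

pairs⊆pathEdges : ∀ {n m} {c : Fin n} {s : Fin m} l → (c , s) ∈ l → (c , s) ∈ pathEdges l
pairs⊆pathEdges (_ ∷ [])    (here refl) = here refl
pairs⊆pathEdges (_ ∷ _ ∷ r) (here refl) = here refl
pairs⊆pathEdges (_ ∷ y ∷ r) (there i)   = there (there (pairs⊆pathEdges (y ∷ r) i))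

pathEdge-client : ∀ {n m} {c : Fin n} {s : Fin m} l → (c , s) ∈ pathEdges l → c ∈ clients l
pathEdge-client (_ ∷ [])    (here refl)         = here refl
pathEdge-client (_ ∷ _ ∷ r) (here refl)         = here refl
pathEdge-client (_ ∷ _ ∷ r) (there (here refl)) = there (here refl)
pathEdge-client (_ ∷ y ∷ r) (there (there i))   = there (pathEdge-client (y ∷ r) i)

pathEdge-server : ∀ {n m} {c : Fin n} {s : Fin m} l → (c , s) ∈ pathEdges l → s ∈ servers l
pathEdge-server (_ ∷ [])    (here refl)         = here refl
pathEdge-server (_ ∷ _ ∷ r) (here refl)         = here refl
pathEdge-server (_ ∷ _ ∷ r) (there (here refl)) = here refl
pathEdge-server (_ ∷ y ∷ r) (there (there i))   = there (pathEdge-server (y ∷ r) i)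

unique-client : ∀ {n m} {c : Fin n} {s s′ : Fin m} l → Unique (clients l) → (c , s) ∈ l → (c , s′) ∈ l → s ≡ s′
unique-client (_ ∷ l) u        (here refl) (here refl) = refl
unique-client (_ ∷ l) (a ∷ u) (here refl) (there j)   = ⊥-elim (All.lookup a (∈-map⁺ proj₁ j) refl)
unique-client (_ ∷ l) (a ∷ u) (there i)   (here refl) = ⊥-elim (All.lookup a (∈-map⁺ proj₁ i) refl)
unique-client (_ ∷ l) (a ∷ u) (there i)   (there j)   = unique-client l u i j

unique-server : ∀ {n m} {c c′ : Fin n} {s : Fin m} l → Unique (servers l) → (c , s) ∈ l → (c′ , s) ∈ l → c ≡ c′
unique-server (_ ∷ l) u        (here refl) (here refl) = refl
unique-server (_ ∷ l) (a ∷ u) (here refl) (there j)   = ⊥-elim (All.lookup a (∈-map⁺ proj₂ j) refl)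
unique-server (_ ∷ l) (a ∷ u) (there i)   (here refl) = ⊥-elim (All.lookup a (∈-map⁺ proj₂ i) refl)
unique-server (_ ∷ l) (a ∷ u) (there i)   (there j)   = unique-server l u i j

module AlternatingPaths {n m} {E : Fin n → Fin m → Set} {M : EdgeSet n m} where

  pathEdges-cons : ∀ {c c′ s q} → AltPath E M c′ q →
    pathEdges ((c , s) ∷ q) ≡ (c , s) ∷ (c′ , s) ∷ pathEdges q
  pathEdges-cons (last _ _ _)   = refl
  pathEdges-cons (cons _ _ _ _) = refl

  first-client : ∀ {h p} → AltPath E M h p → h ∈ clients p
  first-client (last _ _ _)   = here refl
  first-client (cons _ _ _ _) = here refl

  first-pair : ∀ {h p} → AltPath E M h p → Σ (Fin m) λ s → (h , s) ∈ p
  first-pair (last _ _ _)   = _ , here refl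
  first-pair (cons _ _ _ _) = _ , here refl

  pair-edge : ∀ {h p c s} → AltPath E M h p → (c , s) ∈ p → E c s × M c s ≡ false
  pair-edge (last e f _)   (here refl) = e , f
  pair-edge (cons e f _ _) (here refl) = e , f
  pair-edge (cons _ _ _ a) (there i)   = pair-edge a i

  pathEdge-kind : ∀ {h p c s} → AltPath E M h p → (c , s) ∈ pathEdges p → ((c , s) ∈ p) ⊎ M c s ≡ true
  pathEdge-kind (last _ _ _) (here refl) = inj₁ (here refl)
  pathEdge-kind {c = c} {s} (cons _ _ t a) i with subst ((c , s) ∈_) (pathEdges-cons a) i
  ... | here refl         = inj₁ (here refl)
  ... | there (here refl) = inj₂ t
  ... | there (there j)   with pathEdge-kind a j
  ...   | inj₁ x = inj₁ (there x)
  ...   | inj₂ y = inj₂ y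

  pair-server : ∀ {h p c s} → AltPath E M h p → (c , s) ∈ p →
    ServerFree M s ⊎ Σ (Fin n) λ c′ → c′ ∈ clients p × M c′ s ≡ true
  pair-server (last _ _ fr)  (here refl) = inj₁ fr
  pair-server (cons _ _ t a) (here refl) = inj₂ (_ , there (first-client a) , t)
  pair-server (cons _ _ _ a) (there i) with pair-server a i
  ... | inj₁ fr             = inj₁ fr
  ... | inj₂ (c′ , j , mc′) = inj₂ (c′ , there j , mc′)

  inner-client-matched : ∀ {h p c} → AltPath E M h p → c ∈ clients p → c ≢ h → Σ (Fin m) λ s → M c s ≡ true
  inner-client-matched (last _ _ _)   (here refl) c≢h = ⊥-elim (c≢h refl)
  inner-client-matched (cons _ _ _ _) (here refl) c≢h = ⊥-elim (c≢h refl)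
  inner-client-matched {c = c} (cons {c′ = c′} _ _ t a) (there i) _ with c ≟F c′
  ... | yes refl = _ , t
  ... | no c≢c′  = inner-client-matched a i c≢c′

  inner-client-edge : (∀ c s s′ → M c s ≡ true → M c s′ ≡ true → s ≡ s′) →
    ∀ {h p c s} → AltPath E M h p → c ∈ clients p → c ≢ h → M c s ≡ true → (c , s) ∈ pathEdges p
  inner-client-edge _ (last _ _ _)   (here refl) c≢h _ = ⊥-elim (c≢h refl)
  inner-client-edge _ (cons _ _ _ _) (here refl) c≢h _ = ⊥-elim (c≢h refl)
  inner-client-edge one {c = c} {s} (cons {c′ = c′} _ _ t a) (there i) _ mcs with c ≟F c′
  ... | yes refl rewrite one c s _ mcs t = subst ((c , _) ∈_) (sym (pathEdges-cons a)) (there (here refl))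
  ... | no c≢c′  = subst ((c , s) ∈_) (sym (pathEdges-cons a)) (there (there (inner-client-edge one a i c≢c′ mcs)))

module _ {n m} {E : Fin n → Fin m → Set} {N : EdgeSet n m} (mat : IsMatching E N) where

  matching-edge : ∀ c s → N c s ≡ true → E c s
  matching-edge = proj₁ mat

  one-server : ∀ c s s′ → N c s ≡ true → N c s′ ≡ true → s ≡ s′
  one-server = proj₁ (proj₂ mat)

  one-client : ∀ c c′ s → N c s ≡ true → N c′ s ≡ true → c ≡ c′
  one-client = proj₂ (proj₂ mat)

free-unmatched : ∀ {n m} {N : EdgeSet n m} {c s} → ServerFree N s → N c s ≢ true
free-unmatched free ncs = false≢true (trans (sym (free _)) ncs)

module Augmentation {n m} {E : Fin n → Fin m → Set} {M M′ : EdgeSet n m}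
  (mat : IsMatching E M) {h : Fin n} (h-free : ∀ s → M h s ≡ false)
  {p : List (Fin n × Fin m)} (alt : AltPath E M h p) (simple : Simple p)
  (M′-def : ∀ c s → M′ c s ≡ (M c s xor memb c s (pathEdges p))) where

  open AlternatingPaths {E = E} {M}
  open DecMembership (_≟F_ {n}) using (_∈?_)

  M′-edge : ∀ c s → M′ c s ≡ true → ((c , s) ∈ p) ⊎ ((¬ (c ∈ clients p)) × M c s ≡ true)
  M′-edge c s e rewrite M′-def c s with M c s in mcs | memb c s (pathEdges p) in onp
  ... | true  | true  = ⊥-elim (false≢true e)
  ... | false | false = ⊥-elim (false≢true e)
  ... | false | true  with pathEdge-kind alt (memb⇒∈ c s _ onp)
  ...   | inj₁ pair = inj₁ pair
  ...   | inj₂ mcs′ = ⊥-elim (false≢true (trans (sym mcs) mcs′))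
  M′-edge c s e | true | false = inj₂ (off-path , refl)
    where
    off-path : ¬ (c ∈ clients p)
    off-path c∈p = false≢true (trans (sym onp) (∈⇒memb c s _
      (inner-client-edge (one-server mat) alt c∈p (λ { refl → false≢true (trans (sym (h-free s)) mcs) }) mcs)))

  pair-in-M′ : ∀ {c s} → (c , s) ∈ p → M′ c s ≡ true
  pair-in-M′ {c} {s} i rewrite M′-def c s | proj₂ (pair-edge alt i) = ∈⇒memb c s _ (pairs⊆pathEdges p i)

  off-path-unchanged : ∀ {c} s → ¬ (c ∈ clients p) → M′ c s ≡ M c s
  off-path-unchanged {c} s c∉p
    rewrite M′-def c s | ∉⇒memb c s (pathEdges p) (λ i → c∉p (pathEdge-client p i)) = xor-false (M c s)
    where
    xor-false : ∀ b → (b xor false) ≡ b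
    xor-false true  = refl
    xor-false false = refl

  pair-server-on-path : ∀ {c c′ s} → (c , s) ∈ p → ¬ (c′ ∈ clients p) → M c′ s ≢ true
  pair-server-on-path i c′∉p mc′s with pair-server alt i
  ... | inj₁ free = free-unmatched {N = M} free mc′s
  ... | inj₂ (c″ , c″∈p , mc″s) with one-client mat _ _ _ mc″s mc′s
  ...   | refl = c′∉p c″∈p

  M′-matching : IsMatching E M′
  M′-matching = edge , one-server′ , one-client′
    where
    edge : ∀ c s → M′ c s ≡ true → E c s
    edge c s e with M′-edge c s e
    ... | inj₁ i       = proj₁ (pair-edge alt i)
    ... | inj₂ (_ , x) = matching-edge mat c s x
    one-server′ : ∀ c s s′ → M′ c s ≡ true → M′ c s′ ≡ true → s ≡ s′
    one-server′ c s s′ a b with M′-edge c s a | M′-edge c s′ b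
    ... | inj₁ i         | inj₁ j         = unique-client p (proj₁ simple) i j
    ... | inj₁ i         | inj₂ (c∉p , _) = ⊥-elim (c∉p (∈-map⁺ proj₁ i))
    ... | inj₂ (c∉p , _) | inj₁ j         = ⊥-elim (c∉p (∈-map⁺ proj₁ j))
    ... | inj₂ (_ , x)   | inj₂ (_ , y)   = one-server mat c s s′ x y
    one-client′ : ∀ c c′ s → M′ c s ≡ true → M′ c′ s ≡ true → c ≡ c′
    one-client′ c c′ s a b with M′-edge c s a | M′-edge c′ s b
    ... | inj₁ i         | inj₁ j          = unique-server p (proj₂ simple) i j
    ... | inj₁ i         | inj₂ (c′∉p , y) = ⊥-elim (pair-server-on-path i c′∉p y)
    ... | inj₂ (c∉p , x) | inj₁ j          = ⊥-elim (pair-server-on-path j c∉p x)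
    ... | inj₂ (_ , x)   | inj₂ (_ , y)    = one-client mat c c′ s x y

  -- every client keeps at least its number of M-edges, and h gains one
  M′-larger : suc (size M) ≤ size M′
  M′-larger = sumℕ-mono-< row-≤ h row-h
    where
    row-≤ : ∀ c → count (M c) ≤ count (M′ c)
    row-≤ c with c ∈? clients p
    ... | no c∉p = ≤-reflexive (sumℕ-cong (λ s → cong ind (sym (off-path-unchanged s c∉p))))
    ... | yes c∈p with ∈-map⁻ proj₁ c∈p
    ...   | (_ , s) , i , refl = ≤-trans (count-unique (M c) (one-server mat c))
                                         (count-member (M′ c) s (pair-in-M′ i))
    row-h : count (M h) < count (M′ h)
    row-h rewrite count-empty (M h) h-free = count-member (M′ h) _ (pair-in-M′ (proj₂ (first-pair alt)))

module Reachability {n m} {E : Fin n → Fin m → Set} (E? : ∀ c s → Dec (E c s))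
  {M : EdgeSet n m} (mat : IsMatching E M) where

  open AlternatingPaths {E = E} {M}
  open DecMembership (_≟F_ {m}) using (_∈?_)

  AltStep : Fin m → Fin m → Set
  AltStep r s = Σ (Fin n) λ c → M c r ≡ true × E c s × M c s ≡ false

  AltStep? : ∀ r s → Dec (AltStep r s)
  AltStep? r s = any? (λ c → (M c r Bool.≟ true) ×-dec (E? c s ×-dec (M c s Bool.≟ false)))

  -- every server on a simple augmenting path has an augmenting tail (the rest of the path)
  tail-from-path : ∀ {h p r} → AltPath E M h p → Simple p → r ∈ servers p → AugTail E M r
  tail-from-path (last _ _ free)   _                  (here refl) = inj₁ free
  tail-from-path (cons _ _ mc′r a) (_ ∷ uc , r∉ ∷ us) (here refl) =
    inj₂ (_ , mc′r , _ , a , (uc , us) , All¬⇒¬Any r∉)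
  tail-from-path (cons _ _ _ a)    (_ ∷ uc , _ ∷ us)  (there i)   = tail-from-path a (uc , us) i

  -- a tail from s extends backwards along a step r → s (shortcutting if it already visits r)
  extend-tail : ∀ {r s} → AltStep r s → AugTail E M s → AugTail E M r
  extend-tail {r} {s} (c , mcr , ecs , mcs) (inj₁ free) =
    inj₂ (c , mcr , (c , s) ∷ [] , last ecs mcs free , ([] ∷ [] , [] ∷ []) , r∉)
    where
    r∉ : ¬ (r ∈ s ∷ [])
    r∉ (here refl) = false≢true (trans (sym mcs) mcr)
  extend-tail {r} {s} (c , mcr , ecs , mcs) (inj₂ (c′ , mc′s , q , a , (uc , us) , s∉q)) with r ∈? servers q
  ... | yes r∈q = tail-from-path a (uc , us) r∈q
  ... | no  r∉q = inj₂ (c , mcr , (c , s) ∷ q , cons ecs mcs mc′s a ,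
                        (¬Any⇒All¬ _ c∉q ∷ uc , ¬Any⇒All¬ _ s∉q ∷ us) , r∉)
    where
    c∉q : ¬ (c ∈ clients q)
    c∉q c∈q = r∉q (pathEdge-server q (inner-client-edge (one-server mat) a c∈q c≢c′ mcr))
      where
      c≢c′ : c ≢ c′
      c≢c′ refl = false≢true (trans (sym mcs) mc′s)
    r∉ : ¬ (r ∈ s ∷ servers q)
    r∉ (here refl) = false≢true (trans (sym mcs) mcr)
    r∉ (there r∈q) = r∉q r∈q

  data Walk : Fin m → Fin m → Set where
    stay : ∀ {i} → Walk i i
    step : ∀ {i j k} → AltStep i j → Walk j k → Walk i k

  snoc : ∀ {i j k} → Walk i j → AltStep j k → Walk i k
  snoc stay       st = step st stay
  snoc (step x w) st = step x (snoc w st)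

  walk-tail : ∀ {i k} → Walk i k → ServerFree M k → AugTail E M i
  walk-tail stay        free = inj₁ free
  walk-tail (step st w) free = extend-tail st (walk-tail w free)

  Closed : (Fin m → Bool) → Set
  Closed R = ∀ r s → R r ≡ true → AltStep r s → R s ≡ true

  grow : (Fin m → Bool) → Fin m → Bool
  grow R s = R s ∨ does (any? (λ r → (R r Bool.≟ true) ×-dec AltStep? r s))

  Reached : (Fin m → Bool) → (Fin m → Bool) → Set
  Reached I R = ∀ s → R s ≡ true → Σ (Fin m) λ i → I i ≡ true × Walk i s

  -- Iterate `grow` from I until it stabilises; each non-final round adds a
  -- server, so m + 1 rounds suffice.
  closure : ∀ (I : Fin m → Bool) (fuel : ℕ) (R : Fin m → Bool) → I ⊆ R → Reached I R →
    suc m ≤ count R + fuel →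
    Σ (Fin m → Bool) λ R′ → I ⊆ R′ × Reached I R′ × Closed R′
  closure I zero R I⊆R reached room =
    ⊥-elim (<⇒≱ (s≤s (count≤ R)) (≤-trans room (≤-reflexive (+-identityʳ _))))
  closure I (suc fuel) R I⊆R reached room
    with all? (λ s → (grow R s Bool.≟ true) →-dec (R s Bool.≟ true))
  ... | yes stable = R , I⊆R , reached , closed
    where
    closed : Closed R
    closed r s rr st = stable s (trans (cong (R s ∨_) (dec-true (any? _) (r , rr , st))) (∨-zeroʳ (R s)))
  ... | no unstable with ¬∀⟶∃¬ m _ (λ s → (grow R s Bool.≟ true) →-dec (R s Bool.≟ true)) unstable
  ...   | s , new = closure I fuel (grow R) (λ i e → R⊆grow i (I⊆R i e)) reached′ room′
    where
    R⊆grow : R ⊆ grow R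
    R⊆grow i e rewrite e = refl
    new-server : grow R s ≡ true × R s ≡ false
    new-server with R s in rs | grow R s in gs
    ... | true  | _     = ⊥-elim (new (λ _ → refl))
    ... | false | true  = refl , refl
    ... | false | false = ⊥-elim (new (λ ()))
    reached′ : Reached I (grow R)
    reached′ s e with R s in rs
    ... | true  = reached s rs
    ... | false with witness (any? (λ r → (R r Bool.≟ true) ×-dec AltStep? r s)) e
    ...   | r , rr , st with reached r rr
    ...     | i , ii , w = i , ii , snoc w st
    room′ : suc m ≤ count (grow R) + fuel
    room′ = ≤-trans room (≤-trans (≤-reflexive (+-suc (count R) fuel))
              (+-monoˡ-≤ fuel (count-mono-< R⊆grow s (proj₂ new-server) (proj₁ new-server))))

  tail-or-closed : (I : Fin m → Bool) →
    (Σ (Fin m) λ i → I i ≡ true × AugTail E M i) ⊎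
    (Σ (Fin m → Bool) λ R → I ⊆ R × Closed R × (∀ s → R s ≡ true → Σ (Fin n) λ c → M c s ≡ true))
  tail-or-closed I with closure I (suc m) I (λ _ e → e) (λ s e → s , e , stay) (m≤n+m (suc m) (count I))
  ... | R , I⊆R , reached , closed with any? (λ s → (R s Bool.≟ true) ×-dec all? (λ c → M c s Bool.≟ false))
  ...   | yes (f , rf , free) with reached f rf
  ...     | i , ii , w = inj₁ (i , ii , walk-tail w free)
  tail-or-closed I | R , I⊆R , reached , closed | no none-free = inj₂ (R , I⊆R , closed , matched)
    where
    matched : ∀ s → R s ≡ true → Σ (Fin n) λ c → M c s ≡ true
    matched s rs with ¬∀⟶∃¬ n _ (λ c → M c s Bool.≟ false) (λ free → none-free (s , rs , free))
    ... | c , mcs = c , true-if-not-false (M c s) mcs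

record VertexCover {n m} (E : Fin n → Fin m → Set) : Set where
  field
    coverC : Fin n → Bool
    coverS : Fin m → Bool
    covers : ∀ c s → E c s → coverC c ≡ true ⊎ coverS s ≡ true

  cover-size : ℕ
  cover-size = count coverC + count coverS

matching≤cover : ∀ {n m} {E : Fin n → Fin m → Set} {N : EdgeSet n m} →
  IsMatching E N → (C : VertexCover E) → size N ≤ VertexCover.cover-size C
matching≤cover {E = E} {N} mat C = begin
  size N
    ≤⟨ sumℕ-mono (λ c → sumℕ-mono (λ s → covered c s)) ⟩
  sumℕ (λ c → sumℕ (λ s → ind (N c s ∧ coverC c) + ind (N c s ∧ coverS s)))
    ≡⟨ sumℕ-cong (λ c → sumℕ-distrib (λ s → ind (N c s ∧ coverC c)) (λ s → ind (N c s ∧ coverS s))) ⟩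
  sumℕ (λ c → count (λ s → N c s ∧ coverC c) + count (λ s → N c s ∧ coverS s))
    ≡⟨ sumℕ-distrib (λ c → count (λ s → N c s ∧ coverC c)) (λ c → count (λ s → N c s ∧ coverS s)) ⟩
  sumℕ (λ c → count (λ s → N c s ∧ coverC c)) + sumℕ (λ c → count (λ s → N c s ∧ coverS s))
    ≡⟨ cong (sumℕ (λ c → count (λ s → N c s ∧ coverC c)) +_) (sumℕ-comm (λ c s → ind (N c s ∧ coverS s))) ⟩
  sumℕ (λ c → count (λ s → N c s ∧ coverC c)) + sumℕ (λ s → count (λ c → N c s ∧ coverS s))
    ≤⟨ +-mono-≤ (sumℕ-mono (λ c → count-unique-∧ (N c) (coverC c) (one-server mat c)))
                (sumℕ-mono (λ s → count-unique-∧ (λ c → N c s) (coverS s) (λ c c′ → one-client mat c c′ s))) ⟩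
  count coverC + count coverS ∎
  where
  open ≤-Reasoning
  open VertexCover C
  -- each matching edge is counted at its covered endpoint
  covered : ∀ c s → ind (N c s) ≤ ind (N c s ∧ coverC c) + ind (N c s ∧ coverS s)
  covered c s with N c s in e
  ... | false = z≤n
  ... | true  with covers c s (matching-edge mat c s e)
  ...   | inj₁ x rewrite x = s≤s z≤n
  ...   | inj₂ y rewrite y = m≤n+m _ _

-- After t arrivals the SAP matching M is a matching of
-- the current graph whose matched clients are exactly the arrived clients of
-- C_M, and M is maximum, as certified by a vertex cover of the same size
-- (König's theorem, maintained along the run).

edge? : ∀ {n m} (Adj : Adjacency n m) t c s → Dec (Edge Adj t c s)
edge? Adj t c s = (toℕ c <? t) ×-dec (Adj c s Bool.≟ true)

record SAPInvariant {n m} (Adj : Adjacency n m) (t : ℕ) (M : EdgeSet n m) : Set where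
  field
    matching          : IsMatching (Edge Adj t) M
    matched⇒increased : ∀ c s → M c s ≡ true → MaxIncreasedAt Adj (toℕ c)
    increased⇒matched : ∀ c → toℕ c < t → MaxIncreasedAt Adj (toℕ c) → Σ (Fin m) λ s → M c s ≡ true
    cover             : VertexCover (Edge Adj t)
    tight             : VertexCover.cover-size cover ≤ size M

invariant-start : ∀ {n m} (Adj : Adjacency n m) → SAPInvariant Adj 0 (λ _ _ → false)
invariant-start {n} {m} Adj = record
  { matching          = (λ c s ()) , (λ c s s′ ()) , (λ c c′ s ())
  ; matched⇒increased = λ c s ()
  ; increased⇒matched = λ c ()
  ; cover             = record { coverC = λ _ → false ; coverS = λ _ → false ; covers = λ c s () }
  ; tight             = ≤-trans (≤-reflexive (cong₂ _+_ (count-empty {n} _ (λ _ → refl))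
                                                        (count-empty {m} _ (λ _ → refl)))) z≤n
  }

module Arrival {n m} {Adj : Adjacency n m} {t : ℕ} {M : EdgeSet n m}
  (inv : SAPInvariant Adj t M) (t<n : t < n) where

  open SAPInvariant inv
  open VertexCover cover

  G′ : Fin n → Fin m → Set
  G′ = Edge Adj (suc t)

  new : Fin n
  new = fromℕ< t<n

  new-unmatched : ∀ s → M new s ≡ false
  new-unmatched s with M new s in e
  ... | false = refl
  ... | true  = ⊥-elim (<-irrefl (toℕ-fromℕ< t<n) (proj₁ (matching-edge matching new s e)))

  earlier : ∀ c → toℕ c < suc t → c ≢ new → toℕ c < t
  earlier c c≤t c≢new with m<1+n⇒m<n∨m≡n c≤t
  ... | inj₁ c<t = c<t
  ... | inj₂ c≡t = ⊥-elim (c≢new (toℕ-injective (trans c≡t (sym (toℕ-fromℕ< t<n)))))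

  matching′ : IsMatching G′ M
  matching′ = (λ c s e → let (c<t , a) = matching-edge matching c s e in m<n⇒m<1+n c<t , a)
            , one-server matching , one-client matching

  maximum : ∀ N → IsMatching (Edge Adj t) N → size N ≤ size M
  maximum N mat = ≤-trans (matching≤cover mat cover) tight

  -- Augmenting along p: the new client joins the cover, M grows by one edge.
  augmented : ∀ {p M′} → AltPath G′ M new p → Simple p →
    (∀ c s → M′ c s ≡ (M c s xor memb c s (pathEdges p))) → SAPInvariant Adj (suc t) M′
  augmented {p} {M′} alt simple M′-def = record
    { matching          = M′-matching
    ; matched⇒increased = matched⇒increased′
    ; increased⇒matched = increased⇒matched′
    ; cover             = cover′
    ; tight             = tight′
    }
    where
    open Augmentation matching′ new-unmatched alt simple M′-def
    open AlternatingPaths {E = G′} {M}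
    open DecMembership (_≟F_ {n}) using (_∈?_)

    cover′ : VertexCover G′
    cover′ = record { coverC = λ c → coverC c ∨ does (c ≟F new) ; coverS = coverS ; covers = covers′ }
      where
      covers′ : ∀ c s → G′ c s → coverC c ∨ does (c ≟F new) ≡ true ⊎ coverS s ≡ true
      covers′ c s (c≤t , a) with c ≟F new
      ... | yes refl = inj₁ (∨-zeroʳ (coverC new))
      ... | no c≢new with covers c s (earlier c c≤t c≢new , a)
      ...   | inj₁ x rewrite x = inj₁ refl
      ...   | inj₂ y = inj₂ y

    tight′ : VertexCover.cover-size cover′ ≤ size M′
    tight′ = begin
      count (λ c → coverC c ∨ is-new c) + count coverS  ≤⟨ +-monoˡ-≤ (count coverS) (count-∪ coverC is-new) ⟩
      count coverC + count is-new + count coverS       ≤⟨ +-monoˡ-≤ (count coverS) (+-monoʳ-≤ (count coverC) singleton) ⟩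
      count coverC + 1 + count coverS                  ≡⟨ cong (_+ count coverS) (+-comm (count coverC) 1) ⟩
      suc (count coverC + count coverS)                ≤⟨ s≤s tight ⟩
      suc (size M)                                     ≤⟨ M′-larger ⟩
      size M′                                          ∎
      where
      open ≤-Reasoning
      is-new : Fin n → Bool
      is-new c = does (c ≟F new)
      singleton : count is-new ≤ 1
      singleton = count-unique is-new (λ i j i≡ j≡ → trans (witness (i ≟F new) i≡) (sym (witness (j ≟F new) j≡)))

    new-increased : MaxIncreasedAt Adj (toℕ new)
    new-increased rewrite toℕ-fromℕ< t<n =
      M′ , M′-matching , λ N mat → ≤-trans (s≤s (maximum N mat)) M′-larger

    matched⇒increased′ : ∀ c s → M′ c s ≡ true → MaxIncreasedAt Adj (toℕ c)
    matched⇒increased′ c s e with M′-edge c s e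
    ... | inj₂ (_ , mcs) = matched⇒increased c s mcs
    ... | inj₁ i with c ≟F new
    ...   | yes refl  = new-increased
    ...   | no c≢new = matched⇒increased c _ (proj₂ (inner-client-matched alt (∈-map⁺ proj₁ i) c≢new))

    increased⇒matched′ : ∀ c → toℕ c < suc t → MaxIncreasedAt Adj (toℕ c) → Σ (Fin m) λ s → M′ c s ≡ true
    increased⇒matched′ c c≤t inc with c ≟F new
    ... | yes refl = proj₁ (first-pair alt) , pair-in-M′ (proj₂ (first-pair alt))
    ... | no c≢new with increased⇒matched c (earlier c c≤t c≢new) inc | c ∈? clients p
    ...   | _ , _   | yes c∈p with ∈-map⁻ proj₁ c∈p
    ...     | (_ , s) , i , refl = s , pair-in-M′ i
    increased⇒matched′ c c≤t inc | no c≢new | s , mcs | no c∉p = s , trans (off-path-unchanged s c∉p) mcs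

  open Reachability (edge? Adj (suc t)) matching′

  neighbour : Fin m → Bool
  neighbour s = does (edge? Adj (suc t) new s)

  -- Without augmenting paths from the new client: the servers reachable by
  -- alternating steps from its neighbours form a closed set R of matched
  -- servers.  Swapping, in the cover, the clients matched into R (and the
  -- new client) for R itself gives a cover of the new graph of the same size,
  -- so M stays maximum and the new client is not in C_M.
  module Skipped (R : Fin m → Bool) (neighbour⊆R : neighbour ⊆ R) (closed : Closed R)
    (matched : ∀ s → R s ≡ true → Σ (Fin n) λ c → M c s ≡ true) where

    matched-into-R? : ∀ c → Dec (Σ (Fin m) λ s → R s ≡ true × M c s ≡ true)
    matched-into-R? c = any? (λ s → (R s Bool.≟ true) ×-dec (M c s Bool.≟ true))

    leaving : Fin n → Bool
    leaving c = does (c ≟F new) ∨ does (matched-into-R? c)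

    cover′ : VertexCover G′
    cover′ = record
      { coverC = λ c → coverC c ∧ not (leaving c) ; coverS = λ s → coverS s ∨ R s ; covers = covers′ }
      where
      inR : ∀ {s} → R s ≡ true → coverS s ∨ R s ≡ true
      inR {s} rs = trans (cong (coverS s ∨_) rs) (∨-zeroʳ (coverS s))
      covers′ : ∀ c s → G′ c s → coverC c ∧ not (leaving c) ≡ true ⊎ coverS s ∨ R s ≡ true
      covers′ c s e@(c≤t , a) with c ≟F new
      ... | yes refl = inj₂ (inR (neighbour⊆R s (dec-true (edge? Adj (suc t) new s) e)))
      ... | no c≢new with matched-into-R? c
      ...   | yes (y , ry , mcy) = inj₂ (inR rs)
        where
        rs : R s ≡ true
        rs with M c s in mcs
        ... | true  with one-server matching c y s mcy mcs
        ...   | refl = ry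
        rs | false = closed y s ry (c , mcy , e , mcs)
      ...   | no _ with covers c s (earlier c c≤t c≢new , a)
      ...     | inj₁ x rewrite x = inj₁ refl
      ...     | inj₂ y rewrite y = inj₂ refl

    -- the servers of R outside the old cover are matched to leaving clients of the old cover
    tight′ : VertexCover.cover-size cover′ ≤ size M
    tight′ = ≤-trans (begin
      count kept + count (λ s → coverS s ∨ R s)        ≤⟨ +-monoʳ-≤ (count kept) (count-∪-new coverS R) ⟩
      count kept + (count coverS + count added)        ≤⟨ +-monoʳ-≤ (count kept) (+-monoʳ-≤ (count coverS) added≤left) ⟩
      count kept + (count coverS + count left)         ≡⟨ cong (count kept +_) (+-comm (count coverS) (count left)) ⟩
      count kept + (count left + count coverS)         ≡⟨ sym (+-assoc (count kept) (count left) (count coverS)) ⟩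
      count kept + count left + count coverS           ≡⟨ cong (_+ count coverS) (count-split coverC leaving) ⟩
      count coverC + count coverS                      ∎) tight
      where
      open ≤-Reasoning
      kept : Fin n → Bool
      kept c = coverC c ∧ not (leaving c)
      left : Fin n → Bool
      left c = coverC c ∧ leaving c
      added : Fin m → Bool
      added s = R s ∧ not (coverS s)
      added≤left : count added ≤ count left
      added≤left = count-injection added left M partner (one-server matching)
        where
        partner : ∀ s → added s ≡ true → Σ (Fin n) λ c → M c s ≡ true × left c ≡ true
        partner s as with R s in rs | coverS s in cs
        ... | true | false with matched s rs
        ...   | c , mcs with covers c s (matching-edge matching c s mcs)
        ...     | inj₂ y = ⊥-elim (false≢true (trans (sym cs) y))
        ...     | inj₁ x = c , mcs , trans (cong (_∧ leaving c) x)
                  (trans (cong (does (c ≟F new) ∨_) (dec-true (matched-into-R? c) (s , rs , mcs))) (∨-zeroʳ _))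

    skipped : SAPInvariant Adj (suc t) M
    skipped = record
      { matching          = matching′
      ; matched⇒increased = matched⇒increased
      ; increased⇒matched = increased⇒matched′
      ; cover             = cover′
      ; tight             = tight′
      }
      where
      increased⇒matched′ : ∀ c → toℕ c < suc t → MaxIncreasedAt Adj (toℕ c) → Σ (Fin m) λ s → M c s ≡ true
      increased⇒matched′ c c≤t inc with c ≟F new
      ... | no c≢new = increased⇒matched c (earlier c c≤t c≢new) inc
      ... | yes refl with subst (MaxIncreasedAt Adj) (toℕ-fromℕ< t<n) inc
      ...   | N , mat , larger = ⊥-elim (<⇒≱ (larger M matching) (≤-trans (matching≤cover mat cover′) tight′))

  neighbour-tail-path : ∀ s → neighbour s ≡ true → AugTail G′ M s →
    Σ _ λ q → AltPath G′ M new q × Simple q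
  neighbour-tail-path s nb (inj₁ free) =
    _ , last (witness (edge? Adj (suc t) new s) nb) (new-unmatched s) free , ([] ∷ [] , [] ∷ [])
  neighbour-tail-path s nb (inj₂ (c , mcs , q , a , (uc , us) , s∉q)) =
    _ , cons (witness (edge? Adj (suc t) new s) nb) (new-unmatched s) mcs a ,
    (¬Any⇒All¬ _ new∉q ∷ uc , ¬Any⇒All¬ _ s∉q ∷ us)
    where
    open AlternatingPaths {E = G′} {M}
    new∉q : ¬ (new ∈ clients q)
    new∉q new∈q with new ≟F c
    ... | yes refl   = false≢true (trans (sym (new-unmatched s)) mcs)
    ... | no new≢c with inner-client-matched a new∈q new≢c
    ...   | s′ , m′ = false≢true (trans (sym (new-unmatched s′)) m′)

  skipped : (∀ q → AltPath G′ M new q → Simple q → ⊥) → SAPInvariant Adj (suc t) M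
  skipped no-path with tail-or-closed neighbour
  ... | inj₁ (s , nb , tail) with neighbour-tail-path s nb tail
  ...   | q , alt , simple = ⊥-elim (no-path q alt simple)
  skipped no-path | inj₂ (R , neighbour⊆R , closed , matched) = Skipped.skipped R neighbour⊆R closed matched

-- Every reachable SAP state satisfies the invariant.
sap-invariant : ∀ {n m} {Adj : Adjacency n m} {t M} → SAPRun Adj t M → SAPInvariant Adj t M
sap-invariant {Adj = Adj} start = invariant-start Adj
sap-invariant (augment t<n run alt simple _ M′-def) =
  Arrival.augmented (sap-invariant run) t<n alt simple M′-def
sap-invariant (skip t<n run no-path) = Arrival.skipped (sap-invariant run) t<n no-path

record BalancedLoad {n m} (E : Fin n → Fin m → Set) (M : EdgeSet n m) (α : Fin m → ℚ) : Set where
  field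
    x        : Fin n → Fin m → ℚ
    nonneg   : ∀ c s → 0ℚ ℚ.≤ x c s
    support  : ∀ c s → x c s ≢ 0ℚ → E c s × Σ (Fin m) λ s′ → M c s′ ≡ true
    unit-row : ∀ c s → M c s ≡ true → sumℚ (x c) ≡ 1ℚ
    column   : ∀ s → sumℚ (λ c → x c s) ≡ α s
    balanced : ∀ c s → x c s ≢ 0ℚ → ∀ s′ → E c s′ → α s ℚ.≤ α s′

  vanishes : ∀ c s → ¬ (x c s ≢ 0ℚ) → x c s ≡ 0ℚ
  vanishes c s = decidable-stable (x c s ℚ.≟ 0ℚ)

  inflow : Fin n → (Fin m → Bool) → ℚ
  inflow c L = sumℚ (λ s → restrict (L s) (x c s))

  load : (Fin m → Bool) → ℚ
  load L = sumℚ (λ s → restrict (L s) (α s))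

  load≡inflows : ∀ L → load L ≡ sumℚ (λ c → inflow c L)
  load≡inflows L = begin
    sumℚ (λ s → restrict (L s) (α s))                   ≡⟨ sumℚ-cong (λ s → cong (restrict (L s)) (sym (column s))) ⟩
    sumℚ (λ s → restrict (L s) (sumℚ (λ c → x c s)))    ≡⟨ sumℚ-cong (λ s → sumℚ-restrict (L s) (λ c → x c s)) ⟩
    sumℚ (λ s → sumℚ (λ c → restrict (L s) (x c s)))    ≡⟨ sumℚ-comm (λ s c → restrict (L s) (x c s)) ⟩
    sumℚ (λ c → inflow c L)                             ∎
    where open ≡-Reasoning

  inflow-nonneg : ∀ c L → 0ℚ ℚ.≤ inflow c L
  inflow-nonneg c L = sumℚ-nonneg _ (λ s → nonneg-restrict (L s) s)
    where
    nonneg-restrict : ∀ b s → 0ℚ ℚ.≤ restrict b (x c s)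
    nonneg-restrict true  s = nonneg c s
    nonneg-restrict false s = ℚP.≤-refl

  inflow≤1 : ∀ c s₀ L → M c s₀ ≡ true → inflow c L ℚ.≤ 1ℚ
  inflow≤1 c s₀ L mcs₀ = subst (inflow c L ℚ.≤_) (unit-row c s₀ mcs₀) (sumℚ-mono (λ s → part (L s) s))
    where
    part : ∀ b s → restrict b (x c s) ℚ.≤ x c s
    part true  s = ℚP.≤-refl
    part false s = nonneg c s

  inflow≡1 : ∀ c s₀ L → M c s₀ ≡ true → (∀ s → x c s ≢ 0ℚ → L s ≡ true) → inflow c L ≡ 1ℚ
  inflow≡1 c s₀ L mcs₀ inside = trans (sumℚ-cong (λ s → all (L s) s refl)) (unit-row c s₀ mcs₀)
    where
    all : ∀ b s → L s ≡ b → restrict b (x c s) ≡ x c s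
    all true  s _  = refl
    all false s ls = sym (vanishes c s (λ nz → false≢true (trans (sym ls) (inside s nz))))

  inflow≡0 : ∀ c L → (∀ s → x c s ≢ 0ℚ → L s ≡ false) → inflow c L ≡ 0ℚ
  inflow≡0 c L outside = trans (sumℚ-cong (λ s → none (L s) s refl)) (sumℚ-zeros {m})
    where
    none : ∀ b s → L s ≡ b → restrict b (x c s) ≡ 0ℚ
    none false s _  = refl
    none true  s ls = vanishes c s (λ nz → false≢true (trans (sym (outside s nz)) ls))

  size≤load : ∀ L → (∀ s → L s ≡ true → 1ℚ ℚ.≤ α s) → ι (count L) ℚ.≤ load L
  size≤load L heavy = subst (ℚ._≤ load L) (sumℚ-count L) (sumℚ-mono (λ s → each s (L s) refl))
    where
    each : ∀ s b → L s ≡ b → restrict b 1ℚ ℚ.≤ restrict b (α s)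
    each s true  ls = heavy s ls
    each s false _  = ℚP.≤-refl

  load<size : ∀ L j → L j ≡ true → (∀ s → L s ≡ true → α s ℚ.< 1ℚ) → load L ℚ.< ι (count L)
  load<size L j lj light = subst (load L ℚ.<_) (sumℚ-count L)
    (sumℚ-mono-< (λ s → each s (L s) refl) j (strict (L j) refl))
    where
    each : ∀ s b → L s ≡ b → restrict b (α s) ℚ.≤ restrict b 1ℚ
    each s true  ls = ℚP.<⇒≤ (light s ls)
    each s false _  = ℚP.≤-refl
    strict : ∀ b → L j ≡ b → restrict b (α j) ℚ.< restrict b 1ℚ
    strict true ls = light j ls
    strict false ls = ⊥-elim (false≢true (trans (sym ls) lj))


module Tails {n m} {E : Fin n → Fin m → Set} (E? : ∀ c s → Dec (E c s))
  {M : EdgeSet n m} (mat : IsMatching E M) {α : Fin m → ℚ} (bl : BalancedLoad E M α) where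

  open BalancedLoad bl
  open Reachability E? mat

  -- (⇒) Let T be the saturated servers (load ≥ 1) and K the matched clients
  -- all of whose neighbours are saturated.  Only K sends flow into T, at most
  -- 1 per client, so |T| ≤ |K|; as the mates of K lie in T, every saturated
  -- server is the mate of a K-client, and alternating paths from K stay in T.

  saturated : Fin m → Bool
  saturated s = does (1ℚ ℚ.≤? α s)

  Locked : Fin n → Set
  Locked c = (Σ (Fin m) λ s → M c s ≡ true) × (∀ s → E c s → saturated s ≡ true)

  locked? : ∀ c → Dec (Locked c)
  locked? c = any? (λ s → M c s Bool.≟ true) ×-dec all? (λ s → E? c s →-dec (saturated s Bool.≟ true))

  locked : Fin n → Bool
  locked c = does (locked? c)

  locked-neighbour : ∀ {c s} → locked c ≡ true → E c s → saturated s ≡ true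
  locked-neighbour {c} {s} lc = proj₂ (witness (locked? c) lc) s

  held? : ∀ s → Dec (Σ (Fin n) λ c → locked c ≡ true × M c s ≡ true)
  held? s = any? (λ c → (locked c Bool.≟ true) ×-dec (M c s Bool.≟ true))

  held : Fin m → Bool
  held s = does (held? s)

  inflow-saturated : ∀ c → inflow c saturated ℚ.≤ restrict (locked c) 1ℚ
  inflow-saturated c = bound (locked? c)
    where
    bound : (d : Dec (Locked c)) → inflow c saturated ℚ.≤ restrict (does d) 1ℚ
    bound (yes ((s₀ , mcs₀) , _)) = inflow≤1 c s₀ saturated mcs₀
    bound (no not-locked) = ℚP.≤-reflexive (inflow≡0 c saturated avoids)
      where
      avoids : ∀ s → x c s ≢ 0ℚ → saturated s ≡ false
      avoids s nz with ¬∀⟶∃¬ m _ (λ s′ → E? c s′ →-dec (saturated s′ Bool.≟ true))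
                          (λ all-sat → not-locked (proj₂ (support c s nz) , all-sat))
      ... | s′ , not-sat = dec-false (1ℚ ℚ.≤? α s) (λ 1≤αs → unsat (ℚP.≤-trans 1≤αs (balanced c s nz s′ e′)))
        where
        e′ : E c s′
        e′ with E? c s′
        ... | yes e = e
        ... | no ¬e = ⊥-elim (not-sat (λ e → ⊥-elim (¬e e)))
        unsat : ¬ (1ℚ ℚ.≤ α s′)
        unsat 1≤αs′ = not-sat (λ _ → dec-true (1ℚ ℚ.≤? α s′) 1≤αs′)

  saturated⊆held : saturated ⊆ held
  saturated⊆held = count-⊆-antisym held⊆saturated (≤-trans saturated≤locked locked≤held)
    where
    held⊆saturated : held ⊆ saturated
    held⊆saturated s hs with witness (held? s) hs
    ... | c , lc , mcs = locked-neighbour lc (matching-edge mat c s mcs)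
    saturated≤locked : count saturated ≤ count locked
    saturated≤locked = ι-cancel-≤ (begin
      ι (count saturated)                       ≤⟨ size≤load saturated (λ s → witness (1ℚ ℚ.≤? α s)) ⟩
      load saturated                            ≡⟨ load≡inflows saturated ⟩
      sumℚ (λ c → inflow c saturated)           ≤⟨ sumℚ-mono inflow-saturated ⟩
      sumℚ (λ c → restrict (locked c) 1ℚ)       ≡⟨ sumℚ-count locked ⟩
      ι (count locked)                          ∎)
      where open ℚP.≤-Reasoning
    locked≤held : count locked ≤ count held
    locked≤held = count-injection locked held (λ s c → M c s) mate (λ s c c′ → one-client mat c c′ s)
      where
      mate : ∀ c → locked c ≡ true → Σ (Fin m) λ s → M c s ≡ true × held s ≡ true
      mate c lc with proj₁ (witness (locked? c) lc)
      ... | s , mcs = s , mcs , dec-true (held? s) (c , lc , mcs)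

  locked-no-path : ∀ {c p} → locked c ≡ true → AltPath E M c p → ⊥
  locked-no-path lc (last e _ free) with witness (held? _) (saturated⊆held _ (locked-neighbour lc e))
  ... | c″ , _ , mc″s = free-unmatched {N = M} free mc″s
  locked-no-path lc (cons e _ mc′s a) with witness (held? _) (saturated⊆held _ (locked-neighbour lc e))
  ... | c″ , lc″ , mc″s with one-client mat _ _ _ mc″s mc′s
  ...   | refl = locked-no-path lc″ a

  tail⇒unsaturated : ∀ s → AugTail E M s → α s ℚ.< 1ℚ
  tail⇒unsaturated s tail with α s ℚ.<? 1ℚ
  ... | yes αs<1 = αs<1
  ... | no αs≮1 with witness (held? s) (saturated⊆held s (dec-true (1ℚ ℚ.≤? α s) (ℚP.≮⇒≥ αs≮1)))
  ...   | c , lc , mcs with tail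
  ...     | inj₁ free = ⊥-elim (free-unmatched {N = M} free mcs)
  ...     | inj₂ (c′ , mc′s , _ , a , _) with one-client mat _ _ _ mcs mc′s
  ...       | refl = ⊥-elim (locked-no-path lc a)

  -- (⇐) If α s < 1 but s has no tail, s lies in a closed set R of matched
  -- servers.  Let L be the servers of R of minimum load and P their mates.
  -- Balance and closedness make each P-client send all its flow into L, so
  -- |L| ≤ |P| ≤ load L < |L|.

  module NoTail (s : Fin m) (αs<1 : α s ℚ.< 1ℚ) (R : Fin m → Bool) (Rs : R s ≡ true) (closed : Closed R)
    (matched : ∀ s → R s ≡ true → Σ (Fin n) λ c → M c s ≡ true) where

    r₀ : Fin m
    r₀ = proj₁ (minimum-on α R s Rs)

    r₀∈R : R r₀ ≡ true
    r₀∈R = proj₁ (proj₂ (minimum-on α R s Rs))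

    minimal : ∀ r → R r ≡ true → α r₀ ℚ.≤ α r
    minimal = proj₂ (proj₂ (minimum-on α R s Rs))

    lowest : Fin m → Bool
    lowest r = R r ∧ does (α r ℚ.≤? α r₀)

    lowest-R : ∀ {r} → lowest r ≡ true → R r ≡ true
    lowest-R {r} lr with R r
    ... | true = refl

    lowest-α : ∀ {r} → lowest r ≡ true → α r ℚ.≤ α r₀
    lowest-α {r} lr with R r
    ... | true = witness (α r ℚ.≤? α r₀) lr

    lowest-intro : ∀ {r} → R r ≡ true → α r ℚ.≤ α r₀ → lowest r ≡ true
    lowest-intro {r} rr le rewrite rr = dec-true (α r ℚ.≤? α r₀) le

    r₀-lowest : lowest r₀ ≡ true
    r₀-lowest = lowest-intro r₀∈R ℚP.≤-refl

    lowest<1 : ∀ r → lowest r ≡ true → α r ℚ.< 1ℚ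
    lowest<1 r lr = ℚP.≤-<-trans (lowest-α lr) (ℚP.≤-<-trans (minimal s Rs) αs<1)

    mate? : ∀ c → Dec (Σ (Fin m) λ l → lowest l ≡ true × M c l ≡ true)
    mate? c = any? (λ l → (lowest l Bool.≟ true) ×-dec (M c l Bool.≟ true))

    mate : Fin n → Bool
    mate c = does (mate? c)

    lowest≤mate : count lowest ≤ count mate
    lowest≤mate = count-injection lowest mate M partner (one-server mat)
      where
      partner : ∀ l → lowest l ≡ true → Σ (Fin n) λ c → M c l ≡ true × mate c ≡ true
      partner l ll with matched l (lowest-R ll)
      ... | c , mcl = c , mcl , dec-true (mate? c) (l , ll , mcl)

    inflow-mate : ∀ c → restrict (mate c) 1ℚ ℚ.≤ inflow c lowest
    inflow-mate c with mate? c
    ... | no _ = inflow-nonneg c lowest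
    ... | yes (l , ll , mcl) = ℚP.≤-reflexive (sym (inflow≡1 c l lowest mcl into-L))
      where
      into-L : ∀ s → x c s ≢ 0ℚ → lowest s ≡ true
      into-L s nz = lowest-intro in-R (ℚP.≤-trans (balanced c s nz l (matching-edge mat c l mcl)) (lowest-α ll))
        where
        in-R : R s ≡ true
        in-R with M c s in mcs
        ... | true with one-server mat c l s mcl mcs
        ...   | refl = lowest-R ll
        in-R | false = closed l s (lowest-R ll) (c , mcl , proj₁ (support c s nz) , mcs)

    absurd : ⊥
    absurd = ℚP.<-irrefl refl (ℚP.≤-<-trans (ι-mono-≤ lowest≤mate) (begin-strict
      ι (count mate)                          ≡⟨ sym (sumℚ-count mate) ⟩
      sumℚ (λ c → restrict (mate c) 1ℚ)       ≤⟨ sumℚ-mono inflow-mate ⟩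
      sumℚ (λ c → inflow c lowest)            ≡⟨ sym (load≡inflows lowest) ⟩
      load lowest                             <⟨ load<size lowest r₀ r₀-lowest lowest<1 ⟩
      ι (count lowest)                        ∎))
      where open ℚP.≤-Reasoning

  unsaturated⇒tail : ∀ s → α s ℚ.< 1ℚ → AugTail E M s
  unsaturated⇒tail s αs<1 with tail-or-closed (λ r → does (r ≟F s))
  ... | inj₁ (r , r≡s , tail) with witness (r ≟F s) r≡s
  ...   | refl = tail
  unsaturated⇒tail s αs<1 | inj₂ (R , s∈R , closed , matched) =
    ⊥-elim (NoTail.absurd s αs<1 R (s∈R s (dec-true (s ≟F s) refl)) closed matched)

-- By the SAP invariant, the balanced server flow of G_M is a balanced load
-- on the SAP matching: its clients (those of C_M) are exactly the matched ones.
flow-is-balanced-load : ∀ {n m} {Adj : Adjacency n m} {t M} {α : Fin m → ℚ} →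
  SAPInvariant Adj t M → IsBalancedServerFlow Adj t α → BalancedLoad (Edge Adj t) M α
flow-is-balanced-load {Adj = Adj} {t} {M} inv (x , nonneg , outside-GM , unit , column , balanced) = record
  { x = x ; nonneg = nonneg ; support = support ; unit-row = λ c s mcs → unit c (in-CM mcs)
  ; column = column ; balanced = λ c s nz s′ e → balanced c s nz s′ (in-CM (proj₂ (proj₂ (support c s nz))) , proj₂ e)
  }
  where
  open SAPInvariant inv
  in-CM : ∀ {c s} → M c s ≡ true → InCM Adj t c
  in-CM {c} {s} mcs = proj₁ (matching-edge matching c s mcs) , matched⇒increased c s mcs
  support : ∀ c s → x c s ≢ 0ℚ → Edge Adj t c s × Σ (Fin _) λ s′ → M c s′ ≡ true
  support c s nz = edge , mate
    where
    edge : Edge Adj t c s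
    edge with edge? Adj t c s
    ... | yes e = e
    ... | no ¬e = ⊥-elim (nz (outside-GM c s (λ ((c<t , _) , a) → ¬e (c<t , a))))
    mate : Σ (Fin _) λ s′ → M c s′ ≡ true
    mate with any? (λ s′ → M c s′ Bool.≟ true)
    ... | yes w = w
    ... | no ¬w = ⊥-elim (nz (outside-GM c s (λ ((c<t , inc) , _) → ¬w (increased⇒matched c c<t inc))))

lemma31 : ∀ {n m} (Adj : Adjacency n m) (t : ℕ) (M : EdgeSet n m) →
    SAPRun Adj t M →
    (α : Fin m → ℚ) → IsBalancedServerFlow Adj t α →
    ∀ (s : Fin m) →
      (AugTail (Edge Adj t) M s → α s ℚ.< 1ℚ) × (α s ℚ.< 1ℚ → AugTail (Edge Adj t) M s)
lemma31 Adj t M run α flow s = tail⇒unsaturated s , unsaturated⇒tail s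
  where
  invariant : SAPInvariant Adj t M
  invariant = sap-invariant run
  open Tails (edge? Adj t) (SAPInvariant.matching invariant) (flow-is-balanced-load invariant flow)
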